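{- Let $X$ be a separator of a multimatroid $Q=(U,\Omega,r)$ and let $A$ be a subtransversal of $\Omega$. Let $U_A$ be the union of the skew classes of $Q$ that meet $A$. Then $X-U_A$ is a separator of $Q|A$.
   Context: A multimatroid $Q=(U,\Omega,r)$ consists of a finite set $U$, a partition $\Omega$ of $U$ into skew classes, and a function $r$ from the set of subtransversals (sets meeting each skew class in at most one element) to the non-negative integers satisfying: (1) $r(\emptyset)=0$; (2) $r(A)\le r(A\cup x)\le r(A)+1$ whenever $x$ lies in a skew class avoiding the subtransversal $A$; (3) $r(A)+r(B)\ge r(A\cup B)+r(A\cap B)$ whenever $A\cup B$ is a subtransversal; (4) $r(A\cup x)-r(A)+r(A\cup y)-r(A)\ge 1$ whenever $x\neq y$ lie in a skew class avoiding the subtransversal $A$. For a subtransversal $A$, $Q|A$ is the multimatroid whose skew classes are those of $Q$ disjoint from $A$, with ground set their union and rank function $S\mapsto r(S\cup A)-r(A)$. A separator of a multimatroid with rank function $\rho$ is a union $X$ of its skew classes such that $\rho(S)=\rho(S\cap X)+\rho(S-X)$ for every subtransversal $S$. -}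

module Defs where

open import Data.Nat using (ℕ; _+_; _∸_; _≤_)
open import Data.Fin using (Fin; _≟_)
open import Data.Fin.Properties using (any?)
open import Data.Fin.Subset using (Subset; _∈_; _∉_; _⊆_; _∪_; _∩_; _─_; ⁅_⁆; ⊤)
open import Data.Fin.Subset.Properties using (_∈?_)
open import Data.Vec using (tabulate)
open import Data.Product using (_×_; ∃; _,_)
open import Relation.Nullary using (¬_)
open import Relation.Nullary.Decidable using (⌊_⌋; _×-dec_)
open import Relation.Binary.PropositionalEquality using (_≡_; _≢_)

-- The partition into skew classes is given by a
-- class-labelling  cls : Fin n → Fin m ; the skew classes are the nonempty
-- fibres of cls (restricted to the ground set G of the multimatroid at hand,
-- which is itself a union of fibres).

module _ {n m : ℕ} (cls : Fin n → Fin m) where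

  Subtransversal : Subset n → Set
  Subtransversal A = ∀ x y → x ∈ A → y ∈ A → cls x ≡ cls y → x ≡ y

  ClassAvoids : Fin n → Subset n → Set
  ClassAvoids x A = ∀ a → a ∈ A → cls a ≢ cls x

  U[_] : Subset n → Subset n
  U[ A ] = tabulate (λ u → ⌊ any? (λ a → (a ∈? A) ×-dec (cls a ≟ cls u)) ⌋)

  UnionOfClasses : Subset n → Subset n → Set
  UnionOfClasses G X = X ⊆ G × (∀ x y → x ∈ X → y ∈ G → cls x ≡ cls y → y ∈ X)

  -- Separator of the multimatroid with ground set G (a union of fibres of cls),
  -- skew classes the fibres of cls inside G, and rank function ρ
  -- (ρ only matters on subtransversals contained in G).
  IsSeparator : (G : Subset n) → (Subset n → ℕ) → Subset n → Set
  IsSeparator G ρ X =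
    UnionOfClasses G X ×
    (∀ S → S ⊆ G → Subtransversal S → ρ S ≡ ρ (S ∩ X) + ρ (S ─ X))

-- A multimatroid Q = (U, Ω, r) with U = Fin n and Ω given by the fibres of cls.
-- The rank function is a total function on subsets; only its values on
-- subtransversals are constrained / used.
record Multimatroid (n m : ℕ) : Set where
  field
    cls : Fin n → Fin m
    r   : Subset n → ℕ
    r-empty : r (Data.Fin.Subset.⊥) ≡ 0
    r-mono  : ∀ A x → Subtransversal cls A → ClassAvoids cls x A → r A ≤ r (A ∪ ⁅ x ⁆)
    r-unit  : ∀ A x → Subtransversal cls A → ClassAvoids cls x A → r (A ∪ ⁅ x ⁆) ≤ ℕ.suc (r A)
    r-submod : ∀ A B → Subtransversal cls (A ∪ B) → r (A ∪ B) + r (A ∩ B) ≤ r A + r B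
    r-skew  : ∀ A x y → Subtransversal cls A → x ≢ y → cls x ≡ cls y → ClassAvoids cls x A →
              1 ≤ (r (A ∪ ⁅ x ⁆) ∸ r A) + (r (A ∪ ⁅ y ⁆) ∸ r A)

  IsSeparatorQ : Subset n → Set
  IsSeparatorQ X = IsSeparator cls ⊤ r X

  -- the minor Q|A : ground set U − U_A, rank S ↦ r(S ∪ A) − r(A)
  ground∣ : Subset n → Subset n
  ground∣ A = ⊤ ─ U[_] cls A

  rank∣ : Subset n → Subset n → ℕ
  rank∣ A S = r (S ∪ A) ∸ r A

module Submission where

-- Write S₁ = S ∩ X, S₂ = S − X, P = A ∩ X and R = A − X.  For a
-- subtransversal S of Q|A the set S ∪ A is a subtransversal of Q, and
-- applying the separator identity of X to S ∪ A, S₁ ∪ A, S₂ ∪ A and A gives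
--   r(S ∪ A) = r(S₁ ∪ P) + r(S₂ ∪ R),   r(S₁ ∪ A) = r(S₁ ∪ P) + r(R),
--   r(S₂ ∪ A) = r(P) + r(S₂ ∪ R),      r(A)      = r(P) + r(R).
-- Since the rank is monotone on subtransversals, r(P) ≤ r(S₁ ∪ P) and
-- r(R) ≤ r(S₂ ∪ R), so the truncated subtractions defining the rank of Q|A
-- are genuine and r(S ∪ A) − r(A) splits as required.  Finally, S misses
-- U_A, so intersecting or subtracting X − U_A from S is the same as doing
-- so with X.

open import Defs
open import Data.Bool using (_∧_; _∨_)
open import Data.Nat using (ℕ; _+_; _∸_; _≤_)
open import Data.Nat.Properties
  using (≤-reflexive; ≤-trans; +-comm; ∸-+-assoc; +-∸-comm; +-∸-assoc; [m+n]∸[m+o]≡n∸o)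
open import Data.Fin using (Fin; _≟_)
open import Data.Fin.Properties using (any?)
open import Data.Fin.Subset
  using (Subset; _∈_; _∉_; _⊆_; _⊂_; _⊃_; _∪_; _∩_; _─_; ⁅_⁆; ⊤; ⊥; inside; outside)
open import Data.Fin.Subset.Properties
  using ( _∈?_; _⊂?_; ⊆-antisym; ∈⊤; ∉⊥; x∈⁅x⁆; x∈⁅y⁆⇒x≡y; x∈p∪q⁺; x∈p∪q⁻; x∈p∩q⁺
        ; ⊆-refl; p⊆p∪q; q⊆p∪q; p∩q⊆p; p─q⊆p; x∈p∧x∉q⇒x∈p─q
        ; ∩-assoc; ∩-idem; ∪-identityˡ; ∩-distribʳ-∪ )
open import Data.Fin.Subset.Induction using (⊃-wellFounded)
open import Induction.WellFounded using (Acc; acc)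
open import Data.Vec using (_∷_; [])
open import Data.Vec.Properties using (lookup⇒[]=; lookup∘tabulate)
open import Data.Product using (_,_; proj₁; proj₂)
open import Data.Sum using (inj₁; inj₂)
open import Relation.Nullary using (¬_; Dec; yes; no; contradiction)
open import Relation.Nullary.Decidable using (⌊_⌋; _×-dec_)
open import Relation.Binary.PropositionalEquality
  using (_≡_; refl; sym; trans; cong; cong₂; subst; module ≡-Reasoning)

private
  variable
    n m : ℕ

∪-distribʳ-─ : (p q r : Subset n) → (p ∪ q) ─ r ≡ (p ─ r) ∪ (q ─ r)
∪-distribʳ-─ []      []      []            = refl
∪-distribʳ-─ (_ ∷ p) (_ ∷ q) (inside  ∷ r) = cong (outside ∷_) (∪-distribʳ-─ p q r)
∪-distribʳ-─ (a ∷ p) (b ∷ q) (outside ∷ r) = cong ((a ∨ b) ∷_) (∪-distribʳ-─ p q r)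

p∩q─q≡⊥ : (p q : Subset n) → (p ∩ q) ─ q ≡ ⊥
p∩q─q≡⊥ []            []            = refl
p∩q─q≡⊥ (_       ∷ p) (inside  ∷ q) = cong (outside ∷_) (p∩q─q≡⊥ p q)
p∩q─q≡⊥ (inside  ∷ p) (outside ∷ q) = cong (outside ∷_) (p∩q─q≡⊥ p q)
p∩q─q≡⊥ (outside ∷ p) (outside ∷ q) = cong (outside ∷_) (p∩q─q≡⊥ p q)

p─q∩q≡⊥ : (p q : Subset n) → (p ─ q) ∩ q ≡ ⊥
p─q∩q≡⊥ []            []            = refl
p─q∩q≡⊥ (_       ∷ p) (inside  ∷ q) = cong (outside ∷_) (p─q∩q≡⊥ p q)
p─q∩q≡⊥ (inside  ∷ p) (outside ∷ q) = cong (outside ∷_) (p─q∩q≡⊥ p q)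
p─q∩q≡⊥ (outside ∷ p) (outside ∷ q) = cong (outside ∷_) (p─q∩q≡⊥ p q)

p─q─q≡p─q : (p q : Subset n) → (p ─ q) ─ q ≡ p ─ q
p─q─q≡p─q []      []            = refl
p─q─q≡p─q (_ ∷ p) (inside  ∷ q) = cong (outside ∷_) (p─q─q≡p─q p q)
p─q─q≡p─q (a ∷ p) (outside ∷ q) = cong (a ∷_) (p─q─q≡p─q p q)

p∩q∩q≡p∩q : (p q : Subset n) → (p ∩ q) ∩ q ≡ p ∩ q
p∩q∩q≡p∩q p q = trans (∩-assoc p q q) (cong (p ∩_) (∩-idem q))

p∩[q─r]≡[p─r]∩q : (p q r : Subset n) → p ∩ (q ─ r) ≡ (p ─ r) ∩ q
p∩[q─r]≡[p─r]∩q []            []      []            = refl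
p∩[q─r]≡[p─r]∩q (inside  ∷ p) (_ ∷ q) (inside  ∷ r) = cong (outside ∷_) (p∩[q─r]≡[p─r]∩q p q r)
p∩[q─r]≡[p─r]∩q (outside ∷ p) (_ ∷ q) (inside  ∷ r) = cong (outside ∷_) (p∩[q─r]≡[p─r]∩q p q r)
p∩[q─r]≡[p─r]∩q (a       ∷ p) (b ∷ q) (outside ∷ r) = cong ((a ∧ b) ∷_) (p∩[q─r]≡[p─r]∩q p q r)

[p─r]─[q─r]≡[p─r]─q : (p q r : Subset n) → (p ─ r) ─ (q ─ r) ≡ (p ─ r) ─ q
[p─r]─[q─r]≡[p─r]─q []      []            []            = refl
[p─r]─[q─r]≡[p─r]─q (_ ∷ p) (inside  ∷ q) (inside  ∷ r) = cong (outside ∷_) ([p─r]─[q─r]≡[p─r]─q p q r)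
[p─r]─[q─r]≡[p─r]─q (_ ∷ p) (outside ∷ q) (inside  ∷ r) = cong (outside ∷_) ([p─r]─[q─r]≡[p─r]─q p q r)
[p─r]─[q─r]≡[p─r]─q (a ∷ p) (outside ∷ q) (outside ∷ r) = cong (a ∷_) ([p─r]─[q─r]≡[p─r]─q p q r)
[p─r]─[q─r]≡[p─r]─q (a ∷ p) (inside  ∷ q) (outside ∷ r) = cong (outside ∷_) ([p─r]─[q─r]≡[p─r]─q p q r)

x∈p─q⇒x∉q : {x : Fin n} (p q : Subset n) → x ∈ p ─ q → x ∉ q
x∈p─q⇒x∉q p q x∈p─q x∈q = ∉⊥ (subst (_ ∈_) (p─q∩q≡⊥ p q) (x∈p∩q⁺ (x∈p─q , x∈q)))

∩-avoiding : (p q r : Subset n) → p ─ r ≡ p → p ∩ (q ─ r) ≡ p ∩ q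
∩-avoiding p q r p─r≡p = trans (p∩[q─r]≡[p─r]∩q p q r) (cong (_∩ q) p─r≡p)

─-avoiding : (p q r : Subset n) → p ─ r ≡ p → p ─ (q ─ r) ≡ p ─ q
─-avoiding p q r p─r≡p = begin
  p ─ (q ─ r)        ≡⟨ cong (_─ (q ─ r)) (sym p─r≡p) ⟩
  (p ─ r) ─ (q ─ r)  ≡⟨ [p─r]─[q─r]≡[p─r]─q p q r ⟩
  (p ─ r) ─ q        ≡⟨ cong (_─ q) p─r≡p ⟩
  p ─ q              ∎
  where open ≡-Reasoning

⊆∁⇒avoids : (p r : Subset n) → p ⊆ ⊤ ─ r → p ─ r ≡ p
⊆∁⇒avoids p r p⊆∁r =
  ⊆-antisym (p─q⊆p p r) (λ x∈p → x∈p∧x∉q⇒x∈p─q x∈p (x∈p─q⇒x∉q ⊤ r (p⊆∁r x∈p)))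

∪-mono-⊆ : {p p' q q' : Subset n} → p ⊆ p' → q ⊆ q' → p ∪ q ⊆ p' ∪ q'
∪-mono-⊆ {p = p} {p'} {q} {q'} p⊆p' q⊆q' x∈ with x∈p∪q⁻ p q x∈
... | inj₁ x∈p = p⊆p∪q q' (p⊆p' x∈p)
... | inj₂ x∈q = q⊆p∪q p' q' (q⊆q' x∈q)

⊆∧⊄⇒≡ : {p q : Subset n} → p ⊆ q → ¬ (p ⊂ q) → p ≡ q
⊆∧⊄⇒≡ {p = p} p⊆q p⊄q = ⊆-antisym p⊆q q⊆p
  where
  q⊆p : _ ⊆ p
  q⊆p {x} x∈q with x ∈? p
  ... | yes x∈p = x∈p
  ... | no  x∉p = contradiction ((λ {y} → p⊆q {y}) , x , x∈q , x∉p) p⊄q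

-- Truncated subtraction splits additively once the subtrahends are dominated:
-- this is the arithmetic behind the additivity of the contracted rank.
∸-split : {a b p q : ℕ} → p ≤ a → q ≤ b →
          (a + b) ∸ (p + q) ≡ ((a + q) ∸ (p + q)) + ((p + b) ∸ (p + q))
∸-split {a} {b} {p} {q} p≤a q≤b = begin
  (a + b) ∸ (p + q)                       ≡⟨ sym (∸-+-assoc (a + b) p q) ⟩
  ((a + b) ∸ p) ∸ q                       ≡⟨ cong (_∸ q) (+-∸-comm b p≤a) ⟩
  ((a ∸ p) + b) ∸ q                       ≡⟨ +-∸-assoc (a ∸ p) q≤b ⟩
  (a ∸ p) + (b ∸ q)                       ≡⟨ cong₂ _+_ (sym first) (sym ([m+n]∸[m+o]≡n∸o p b q)) ⟩
  ((a + q) ∸ (p + q)) + ((p + b) ∸ (p + q)) ∎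
  where
  open ≡-Reasoning
  first : (a + q) ∸ (p + q) ≡ a ∸ p
  first = trans (cong₂ _∸_ (+-comm a q) (+-comm p q)) ([m+n]∸[m+o]≡n∸o q a p)

module _ (cls : Fin n → Fin m) where

  subtransversal-⊆ : {P T : Subset n} → Subtransversal cls T → P ⊆ T → Subtransversal cls P
  subtransversal-⊆ stT P⊆T x y x∈P y∈P = stT x y (P⊆T x∈P) (P⊆T y∈P)

  ∈U : (A : Subset n) (a x : Fin n) → a ∈ A → cls a ≡ cls x → x ∈ U[_] cls A
  ∈U A a x a∈A same = lookup⇒[]= x (U[_] cls A)
    (trans (lookup∘tabulate _ x)
      (decided (any? (λ a → (a ∈? A) ×-dec (cls a ≟ cls x))) (a , a∈A , same)))
    where
    decided : {P : Set} (d : Dec P) → P → ⌊ d ⌋ ≡ inside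
    decided (yes _) _  = refl
    decided (no ¬p) p = contradiction p ¬p

  subtransversal-∪ : (S A : Subset n) → S ⊆ ⊤ ─ U[_] cls A →
                     Subtransversal cls S → Subtransversal cls A → Subtransversal cls (S ∪ A)
  subtransversal-∪ S A S⊆∁U stS stA x y x∈ y∈ same with x∈p∪q⁻ S A x∈ | x∈p∪q⁻ S A y∈
  ... | inj₁ x∈S | inj₁ y∈S = stS x y x∈S y∈S same
  ... | inj₂ x∈A | inj₂ y∈A = stA x y x∈A y∈A same
  ... | inj₁ x∈S | inj₂ y∈A = contradiction (∈U A y x y∈A (sym same)) (x∈p─q⇒x∉q ⊤ _ (S⊆∁U x∈S))
  ... | inj₂ x∈A | inj₁ y∈S = contradiction (∈U A x y x∈A same) (x∈p─q⇒x∉q ⊤ _ (S⊆∁U y∈S))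

  unionOfClasses-─U : (X A : Subset n) → UnionOfClasses cls ⊤ X →
                      UnionOfClasses cls (⊤ ─ U[_] cls A) (X ─ U[_] cls A)
  unionOfClasses-─U X A (_ , closed) =
      (λ x∈X' → x∈p∧x∉q⇒x∈p─q ∈⊤ (x∈p─q⇒x∉q X _ x∈X'))
    , λ x y x∈X' y∈G same →
        x∈p∧x∉q⇒x∈p─q (closed x y (p─q⊆p X _ x∈X') ∈⊤ same) (x∈p─q⇒x∉q ⊤ _ y∈G)

  separator-split : {G : Subset n} {ρ : Subset n → ℕ} {X : Subset n} →
                    IsSeparator cls G ρ X → (B C : Subset n) →
                    B ∪ C ⊆ G → Subtransversal cls (B ∪ C) →
                    ρ (B ∪ C) ≡ ρ (B ∩ X ∪ C ∩ X) + ρ ((B ─ X) ∪ (C ─ X))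
  separator-split {ρ = ρ} {X} (_ , split) B C ⊆G st =
    trans (split (B ∪ C) ⊆G st)
          (cong₂ _+_ (cong ρ (∩-distribʳ-∪ X B C)) (cong ρ (∪-distribʳ-─ B C X)))

module _ (Q : Multimatroid n m) where
  open Multimatroid Q

  rank-mono : {P T : Subset n} → Subtransversal cls T → P ⊆ T → r P ≤ r T
  rank-mono {P} {T} stT = grow P (⊃-wellFounded P)
    where
    grow : (P : Subset n) → Acc _⊃_ P → P ⊆ T → r P ≤ r T
    grow P (acc larger) P⊆T with P ⊂? T
    ... | no  P⊄T = ≤-reflexive (cong r (⊆∧⊄⇒≡ P⊆T P⊄T))
    ... | yes (_ , x , x∈T , x∉P) =
      ≤-trans (r-mono P x (subtransversal-⊆ cls stT P⊆T) avoids)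
              (grow (P ∪ ⁅ x ⁆) (larger P⊂P+x) P+x⊆T)
      where
      avoids : ClassAvoids cls x P
      avoids a a∈P same with stT a x (P⊆T a∈P) x∈T same
      ... | refl = x∉P a∈P
      P⊂P+x : P ⊂ P ∪ ⁅ x ⁆
      P⊂P+x = p⊆p∪q ⁅ x ⁆ , x , q⊆p∪q P ⁅ x ⁆ (x∈⁅x⁆ x) , x∉P
      P+x⊆T : P ∪ ⁅ x ⁆ ⊆ T
      P+x⊆T y∈ with x∈p∪q⁻ P ⁅ x ⁆ y∈
      ... | inj₁ y∈P = P⊆T y∈P
      ... | inj₂ y∈x rewrite x∈⁅y⁆⇒x≡y x y∈x = x∈T

  module _ {X : Subset n} (sepX : IsSeparatorQ X) where

    split-inside : (B C : Subset n) → Subtransversal cls (B ∩ X ∪ C) →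
                   r (B ∩ X ∪ C) ≡ r (B ∩ X ∪ C ∩ X) + r (C ─ X)
    split-inside B C st = begin
      r (B ∩ X ∪ C)                                  ≡⟨ separator-split cls sepX (B ∩ X) C (λ _ → ∈⊤) st ⟩
      r ((B ∩ X) ∩ X ∪ C ∩ X) + r ((B ∩ X ─ X) ∪ (C ─ X))
        ≡⟨ cong₂ (λ Y Z → r (Y ∪ C ∩ X) + r (Z ∪ (C ─ X))) (p∩q∩q≡p∩q B X) (p∩q─q≡⊥ B X) ⟩
      r (B ∩ X ∪ C ∩ X) + r (⊥ ∪ (C ─ X))            ≡⟨ cong (λ Z → r (B ∩ X ∪ C ∩ X) + r Z) (∪-identityˡ (C ─ X)) ⟩
      r (B ∩ X ∪ C ∩ X) + r (C ─ X)                  ∎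
      where open ≡-Reasoning

    split-outside : (B C : Subset n) → Subtransversal cls ((B ─ X) ∪ C) →
                    r ((B ─ X) ∪ C) ≡ r (C ∩ X) + r ((B ─ X) ∪ (C ─ X))
    split-outside B C st = begin
      r ((B ─ X) ∪ C)                                ≡⟨ separator-split cls sepX (B ─ X) C (λ _ → ∈⊤) st ⟩
      r ((B ─ X) ∩ X ∪ C ∩ X) + r (((B ─ X) ─ X) ∪ (C ─ X))
        ≡⟨ cong₂ (λ Y Z → r (Y ∪ C ∩ X) + r (Z ∪ (C ─ X))) (p─q∩q≡⊥ B X) (p─q─q≡p─q B X) ⟩
      r (⊥ ∪ C ∩ X) + r ((B ─ X) ∪ (C ─ X))          ≡⟨ cong (λ Z → r Z + r ((B ─ X) ∪ (C ─ X))) (∪-identityˡ (C ∩ X)) ⟩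
      r (C ∩ X) + r ((B ─ X) ∪ (C ─ X))              ∎
      where open ≡-Reasoning

    contracted-rank-split : (S A : Subset n) → Subtransversal cls (S ∪ A) →
                            rank∣ A S ≡ rank∣ A (S ∩ X) + rank∣ A (S ─ X)
    contracted-rank-split S A st = begin
      r (S ∪ A) ∸ r A
        ≡⟨ cong₂ _∸_ (separator-split cls sepX S A (λ _ → ∈⊤) st) splitA ⟩
      (r S₁+P + r S₂+R) ∸ (r P + r R)
        ≡⟨ ∸-split (rank-mono (sub S₁+P⊆S+A) (q⊆p∪q (S ∩ X) P))
                   (rank-mono (sub S₂+R⊆S+A) (q⊆p∪q (S ─ X) R)) ⟩
      ((r S₁+P + r R) ∸ (r P + r R)) + ((r P + r S₂+R) ∸ (r P + r R))
        ≡⟨ cong (λ c → ((r S₁+P + r R) ∸ c) + ((r P + r S₂+R) ∸ c)) (sym splitA) ⟩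
      ((r S₁+P + r R) ∸ r A) + ((r P + r S₂+R) ∸ r A)
        ≡⟨ sym (cong₂ (λ a b → (a ∸ r A) + (b ∸ r A))
                      (split-inside S A (sub S₁+A⊆S+A)) (split-outside S A (sub S₂+A⊆S+A))) ⟩
      (r (S ∩ X ∪ A) ∸ r A) + (r ((S ─ X) ∪ A) ∸ r A) ∎
      where
      open ≡-Reasoning
      P R S₁+P S₂+R : Subset n
      P = A ∩ X
      R = A ─ X
      S₁+P = S ∩ X ∪ P
      S₂+R = (S ─ X) ∪ R
      splitA : r A ≡ r P + r R
      splitA = proj₂ sepX A (λ _ → ∈⊤) (subtransversal-⊆ cls st (q⊆p∪q S A))
      sub : {Y : Subset n} → Y ⊆ S ∪ A → Subtransversal cls Y
      sub = subtransversal-⊆ cls st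
      S₁+A⊆S+A : S ∩ X ∪ A ⊆ S ∪ A
      S₁+A⊆S+A = ∪-mono-⊆ (p∩q⊆p S X) ⊆-refl
      S₂+A⊆S+A : (S ─ X) ∪ A ⊆ S ∪ A
      S₂+A⊆S+A = ∪-mono-⊆ (p─q⊆p S X) ⊆-refl
      S₁+P⊆S+A : S₁+P ⊆ S ∪ A
      S₁+P⊆S+A = ∪-mono-⊆ (p∩q⊆p S X) (p∩q⊆p A X)
      S₂+R⊆S+A : S₂+R ⊆ S ∪ A
      S₂+R⊆S+A = ∪-mono-⊆ (p─q⊆p S X) (p─q⊆p A X)

lemma10 : {n m : ℕ} (Q : Multimatroid n m) (X A : Subset n) →
    Multimatroid.IsSeparatorQ Q X →
    Subtransversal (Multimatroid.cls Q) A →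
    IsSeparator (Multimatroid.cls Q) (Multimatroid.ground∣ Q A)
    (Multimatroid.rank∣ Q A) (X ─ U[_] (Multimatroid.cls Q) A)
lemma10 {n} Q X A sepX stA = unionOfClasses-─U cls X A (proj₁ sepX) , split
  where
  open Multimatroid Q
  U : Subset n
  U = U[_] cls A

  -- A subtransversal S of Q|A misses U_A, so X − U_A splits it as X does.
  split : ∀ S → S ⊆ ⊤ ─ U → Subtransversal cls S →
          rank∣ A S ≡ rank∣ A (S ∩ (X ─ U)) + rank∣ A (S ─ (X ─ U))
  split S S⊆G stS = begin
    rank∣ A S                                    ≡⟨ contracted-rank-split Q sepX S A st ⟩
    rank∣ A (S ∩ X) + rank∣ A (S ─ X)            ≡⟨ sym (cong₂ (λ Y Z → rank∣ A Y + rank∣ A Z)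
                                                        (∩-avoiding S X U avoids) (─-avoiding S X U avoids)) ⟩
    rank∣ A (S ∩ (X ─ U)) + rank∣ A (S ─ (X ─ U)) ∎
    where
    open ≡-Reasoning
    st : Subtransversal cls (S ∪ A)
    st = subtransversal-∪ cls S A S⊆G stS stA
    avoids : S ─ U ≡ S
    avoids = ⊆∁⇒avoids S U S⊆G
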